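{- Let $w\in W=S_n$. If $\mu\in X(T)$ lies sufficiently deep in the lowest alcove $C_0$, then $(w,\mu)$ is good.
   Context: $X(T)=\mathbb Z^n$, $W=S_n$, $\rho=(n-1,\dots,1,0)$. $C_0=\{\lambda\in\mathbb R^n:0<\langle\lambda+\rho,\alpha^\vee\rangle<p$ for all $\alpha=\epsilon_i-\epsilon_j$, $i<j\}$, where $\langle\lambda,(\epsilon_i-\epsilon_j)^\vee\rangle=\lambda_i-\lambda_j$. $\mu$ is $\delta$-deep in $C_0$ if $\delta<\langle\mu+\rho,\alpha^\vee\rangle<p-\delta$ for all positive $\alpha$; "sufficiently deep" means there is $\delta>0$ independent of $p$ such that the statement holds for all primes $p$ and all $\delta$-deep $\mu$. $(w,\mu)$ is good if for each $1\le i\le n$, with $n_i$ the least positive integer with $w^{n_i}(i)=i$, $\sum_{k\bmod n_i}\mu_{w^k(i)}p^k\not\equiv0\pmod{(p^{n_i}-1)/(p^d-1)}$ for all divisors $d\ne n_i$ of $n_i$. -}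

module Defs where

open import Data.Nat using (ℕ; zero; suc; _+_; _*_; _∸_; _^_; _<_)
open import Data.Nat.Divisibility using () renaming (_∣_ to _∣ℕ_)
open import Data.Nat.Primality using (Prime)
open import Data.Integer as ℤ using (ℤ; +_)
open import Data.Integer.Divisibility using (_∣_)
open import Data.Fin using (Fin; toℕ)
open import Data.Fin.Permutation using (Permutation′; _⟨$⟩ʳ_)
open import Data.Product using (_×_)
open import Relation.Binary.PropositionalEquality using (_≡_; _≢_)
open import Relation.Nullary using (¬_)

iterPerm : ∀ {n} → Permutation′ n → ℕ → Fin n → Fin n
iterPerm w zero    i = i
iterPerm w (suc k) i = w ⟨$⟩ʳ (iterPerm w k i)

IsOrbitLength : ∀ {n} → Permutation′ n → Fin n → ℕ → Set
IsOrbitLength w i m =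
  (0 < m) × (iterPerm w m i ≡ i) × (∀ k → 0 < k → k < m → iterPerm w k i ≢ i)

-- ρ = (n-1, ..., 1, 0), 0-indexed: ρ_i = n-1-i
rho : (n : ℕ) → Fin n → ℤ
rho n i = + (n ∸ 1 ∸ toℕ i)

-- ⟨μ+ρ, (ε_i - ε_j)^∨⟩
pairing : ∀ {n} → (Fin n → ℤ) → Fin n → Fin n → ℤ
pairing {n} μ i j = (μ i ℤ.+ rho n i) ℤ.- (μ j ℤ.+ rho n j)

Deep : (n p δ : ℕ) → (Fin n → ℤ) → Set
Deep n p δ μ = ∀ (i j : Fin n) → toℕ i < toℕ j →
  (+ δ ℤ.< pairing μ i j) × (pairing μ i j ℤ.< + p ℤ.- + δ)

orbitSum : ∀ {n} → Permutation′ n → (Fin n → ℤ) → ℕ → Fin n → ℕ → ℤ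
orbitSum w μ p i zero    = + 0
orbitSum w μ p i (suc m) = orbitSum w μ p i m ℤ.+ μ (iterPerm w m i) ℤ.* + (p ^ m)

-- (w, μ) is good (for the prime p)
-- The modulus (p^{n_i}-1)/(p^d-1) is the natural number M with M·(p^d-1) = p^{n_i}-1.
Good : (n : ℕ) → Permutation′ n → (Fin n → ℤ) → ℕ → Set
Good n w μ p = ∀ (i : Fin n) (ni : ℕ) → IsOrbitLength w i ni →
  ∀ (d : ℕ) → d ∣ℕ ni → d ≢ ni →
  ∀ (M : ℕ) → M * (p ^ d ∸ 1) ≡ p ^ ni ∸ 1 →
  ¬ (+ M ∣ orbitSum w μ p i ni)

module Submission where

-- If μ is n-deep then, since the shifts ρ_i − ρ_j are smaller than n,
-- the entries of μ strictly decrease along the positions by steps below p.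
-- Hence μ_x = c + a_x with c = μ_{last} and a injective with digits a_x < p.
-- For an orbit of w through i of length m = e·d (d a proper divisor, e ≥ 2),
-- the orbit sum is c·(p^m − 1)/(p − 1) + A, where A is the base-p numeral
-- with digits a_{w^k(i)}.  The modulus M = (p^m − 1)/(p^d − 1) divides the
-- first summand, so if it divided the orbit sum it would divide A.  Read in
-- base q = p^d, A has e digits below q and M = 1 + q + … + q^{e−1}, so all
-- these base-q digits are equal; comparing the first two yields
-- a_i = a_{w^d(i)}, whence w^d(i) = i, contradicting minimality of m.

open import Defs
open import Data.Nat using (ℕ)
open import Data.Nat.Primality using (Prime)
open import Data.Integer using (ℤ)
open import Data.Fin using (Fin)
open import Data.Fin.Permutation using (Permutation′)
open import Data.Product using (∃)

open import Data.Nat using (zero; suc; _+_; _*_; _∸_; _^_; _<_; _≤_; z≤n; s≤s)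
open import Data.Nat.Properties
open import Data.Nat.Base using (nonTrivial⇒n>1)
open import Data.Nat.Primality using (prime⇒nonTrivial)
open import Data.Nat.DivMod using (_%_; m<n⇒m%n≡m; [m+kn]%n≡m%n)
open import Data.Nat.Divisibility using (divides) renaming (_∣_ to _∣ℕ_)
open import Data.Nat.Tactic.RingSolver using (solve-∀)
open import Data.Product using (_×_; _,_; proj₁; proj₂)
open import Data.Sum using (inj₁; inj₂)
open import Relation.Nullary using (contradiction)
open import Relation.Binary.Definitions using (tri<; tri≈; tri>)
open import Data.Fin using (toℕ; fromℕ)
open import Data.Fin.Properties using (toℕ-injective; toℕ-fromℕ; toℕ≤pred[n])
import Data.Integer as ℤ
import Data.Integer.Properties as ℤₚ
import Data.Integer.Divisibility.Signed as ℤ∣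
import Data.Integer.Tactic.RingSolver as ℤRing
open import Algebra.Bundles using (AbelianGroup)
open import Algebra.Properties.Group (AbelianGroup.group ℤₚ.+-0-abelianGroup) using (∙-cancelˡ)
open import Relation.Binary.PropositionalEquality
  using (_≡_; _≢_; refl; sym; trans; cong; cong₂; subst; subst₂; module ≡-Reasoning)

-- The base-b numeral with digits a 0, a 1, …, a (k − 1) (least significant first).
digits : ℕ → (ℕ → ℕ) → ℕ → ℕ
digits b a zero    = 0
digits b a (suc k) = a 0 + b * digits b (λ j → a (suc j)) k

repunit : ℕ → ℕ → ℕ
repunit b = digits b (λ _ → 1)

block : ℕ → ℕ → (ℕ → ℕ) → ℕ → ℕ
block b d a j = digits b (λ k → a (j * d + k)) d

digits-cong : ∀ b {a a′ : ℕ → ℕ} k → (∀ j → a j ≡ a′ j) → digits b a k ≡ digits b a′ k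
digits-cong b zero    eq = refl
digits-cong b (suc k) eq =
  cong₂ (λ x y → x + b * y) (eq 0) (digits-cong b k (λ j → eq (suc j)))

digits-snoc : ∀ b a k → digits b a (suc k) ≡ digits b a k + a k * b ^ k
digits-snoc b a zero    =
  trans (cong (a 0 +_) (*-zeroʳ b)) (trans (+-identityʳ (a 0)) (sym (*-identityʳ (a 0))))
digits-snoc b a (suc k) = begin
  a 0 + b * digits b a′ (suc k)           ≡⟨ cong (λ t → a 0 + b * t) (digits-snoc b a′ k) ⟩
  a 0 + b * (digits b a′ k + a′ k * b ^ k) ≡⟨ rearrange b (a 0) (digits b a′ k) (a′ k) (b ^ k) ⟩
  (a 0 + b * digits b a′ k) + a′ k * (b * b ^ k) ∎
  where
  open ≡-Reasoning
  a′ : ℕ → ℕ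
  a′ j = a (suc j)
  rearrange : ∀ b x y z w → x + b * (y + z * w) ≡ (x + b * y) + z * (b * w)
  rearrange = solve-∀

digits-++ : ∀ b d r a → digits b a (d + r) ≡ digits b a d + b ^ d * digits b (λ k → a (d + k)) r
digits-++ b zero    r a = sym (+-identityʳ (digits b a r))
digits-++ b (suc d) r a = begin
  a 0 + b * digits b a′ (d + r)
    ≡⟨ cong (λ t → a 0 + b * t) (digits-++ b d r a′) ⟩
  a 0 + b * (digits b a′ d + b ^ d * digits b (λ k → a′ (d + k)) r)
    ≡⟨ rearrange b (a 0) (digits b a′ d) (b ^ d) (digits b (λ k → a′ (d + k)) r) ⟩
  (a 0 + b * digits b a′ d) + b * b ^ d * digits b (λ k → a (suc d + k)) r ∎
  where
  open ≡-Reasoning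
  a′ : ℕ → ℕ
  a′ j = a (suc j)
  rearrange : ∀ b x y z w → x + b * (y + z * w) ≡ (x + b * y) + b * z * w
  rearrange = solve-∀

digits-blocks : ∀ b d e a → digits b a (e * d) ≡ digits (b ^ d) (block b d a) e
digits-blocks b d zero    a = refl
digits-blocks b d (suc e) a = begin
  digits b a (d + e * d)
    ≡⟨ digits-++ b d (e * d) a ⟩
  block b d a 0 + b ^ d * digits b a′ (e * d)
    ≡⟨ cong (λ t → block b d a 0 + b ^ d * t) (digits-blocks b d e a′) ⟩
  block b d a 0 + b ^ d * digits (b ^ d) (block b d a′) e
    ≡⟨ cong (λ t → block b d a 0 + b ^ d * t) (digits-cong (b ^ d) e shifted-block) ⟩
  block b d a 0 + b ^ d * digits (b ^ d) (λ j → block b d a (suc j)) e ∎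
  where
  open ≡-Reasoning
  a′ : ℕ → ℕ
  a′ k = a (d + k)
  shifted-block : ∀ j → block b d a′ j ≡ block b d a (suc j)
  shifted-block j = digits-cong b d (λ k → cong a (sym (+-assoc d (j * d) k)))

digits-const : ∀ b c k → digits b (λ _ → c) k ≡ c * repunit b k
digits-const b c zero    = sym (*-zeroʳ c)
digits-const b c (suc k) = begin
  c + b * digits b (λ _ → c) k ≡⟨ cong (λ t → c + b * t) (digits-const b c k) ⟩
  c + b * (c * repunit b k)    ≡⟨ rearrange b c (repunit b k) ⟩
  c * (1 + b * repunit b k)    ∎
  where
  open ≡-Reasoning
  rearrange : ∀ b c r → c + b * (c * r) ≡ c * (1 + b * r)
  rearrange = solve-∀

repunit-blocks : ∀ b d e → repunit b (e * d) ≡ repunit b d * repunit (b ^ d) e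
repunit-blocks b d e = trans (digits-blocks b d e (λ _ → 1)) (digits-const (b ^ d) (repunit b d) e)

repunit-snoc : ∀ b k → repunit b (suc k) ≡ repunit b k + b ^ k
repunit-snoc b k = trans (digits-snoc b (λ _ → 1) k) (cong (repunit b k +_) (*-identityˡ (b ^ k)))

-- The geometric series: (1 + b + … + b^(k−1)) · (b − 1) + 1 = b^k, written with b + 1 for b.
repunit-geometric : ∀ b k → repunit (suc b) k * b + 1 ≡ suc b ^ k
repunit-geometric b zero    = refl
repunit-geometric b (suc k) = begin
  (1 + suc b * repunit (suc b) k) * b + 1 ≡⟨ rearrange b (repunit (suc b) k) ⟩
  suc b * (repunit (suc b) k * b + 1)     ≡⟨ cong (suc b *_) (repunit-geometric b k) ⟩
  suc b * suc b ^ k                       ∎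
  where
  open ≡-Reasoning
  rearrange : ∀ b r → (1 + (1 + b) * r) * b + 1 ≡ (1 + b) * (r * b + 1)
  rearrange = solve-∀

repunit-unique : ∀ b k M → 1 < b → M * (b ∸ 1) ≡ b ^ k ∸ 1 → M ≡ repunit b k
repunit-unique (suc zero)    k M (s≤s ()) eq
repunit-unique (suc (suc b)) k M _        eq = *-cancelʳ-≡ M (repunit (2 + b) k) (suc b) (begin
  M * suc b                              ≡⟨ eq ⟩
  (2 + b) ^ k ∸ 1                        ≡⟨ cong (_∸ 1) (sym (repunit-geometric (suc b) k)) ⟩
  repunit (2 + b) k * suc b + 1 ∸ 1      ≡⟨ m+n∸n≡m (repunit (2 + b) k * suc b) 1 ⟩
  repunit (2 + b) k * suc b              ∎)
  where open ≡-Reasoning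

power≤base*repunit : ∀ b k → b ^ suc k ≤ b * repunit b (suc k)
power≤base*repunit b k = *-monoʳ-≤ b (begin
  b ^ k                  ≤⟨ m≤n+m (b ^ k) (repunit b k) ⟩
  repunit b k + b ^ k    ≡⟨ sym (repunit-snoc b k) ⟩
  repunit b (suc k)      ∎)
  where open ≤-Reasoning

euclid-unique : ∀ {b x x′ u u′} → x < b → x′ < b → x + b * u ≡ x′ + b * u′ → x ≡ x′ × u ≡ u′
euclid-unique {suc b} {x} {x′} {u} {u′} x<b x′<b eq = x≡x′ , u≡u′
  where
  open ≡-Reasoning
  remainder : ∀ y v → y < suc b → (y + suc b * v) % suc b ≡ y
  remainder y v y<b = begin
    (y + suc b * v) % suc b ≡⟨ cong (λ t → (y + t) % suc b) (*-comm (suc b) v) ⟩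
    (y + v * suc b) % suc b ≡⟨ [m+kn]%n≡m%n y v (suc b) ⟩
    y % suc b               ≡⟨ m<n⇒m%n≡m y<b ⟩
    y                       ∎
  x≡x′ : x ≡ x′
  x≡x′ = trans (sym (remainder x u x<b)) (trans (cong (_% suc b) eq) (remainder x′ u′ x′<b))
  u≡u′ : u ≡ u′
  u≡u′ = *-cancelˡ-≡ u u′ (suc b) (+-cancelˡ-≡ x _ _ (trans eq (cong (_+ suc b * u′) (sym x≡x′))))

digits-bound : ∀ b a k → (∀ j → a j < b) → digits b a k < b ^ k
digits-bound b a zero    a<b = s≤s z≤n
digits-bound b a (suc k) a<b = begin-strict
  a 0 + b * digits b a′ k  <⟨ +-monoˡ-< (b * digits b a′ k) (a<b 0) ⟩
  b + b * digits b a′ k    ≡⟨ sym (*-suc b (digits b a′ k)) ⟩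
  b * suc (digits b a′ k)  ≤⟨ *-monoʳ-≤ b (digits-bound b a′ k (λ j → a<b (suc j))) ⟩
  b * b ^ k                ∎
  where
  open ≤-Reasoning
  a′ : ℕ → ℕ
  a′ j = a (suc j)

digits-injective : ∀ b a a′ k → (∀ j → a j < b) → (∀ j → a′ j < b) →
  digits b a k ≡ digits b a′ k → ∀ j → j < k → a j ≡ a′ j
digits-injective b a a′ (suc k) a<b a′<b eq zero    _         =
  proj₁ (euclid-unique (a<b 0) (a′<b 0) eq)
digits-injective b a a′ (suc k) a<b a′<b eq (suc j) (s≤s j<k) =
  digits-injective b (λ i → a (suc i)) (λ i → a′ (suc i)) k
    (λ i → a<b (suc i)) (λ i → a′<b (suc i)) (proj₂ (euclid-unique (a<b 0) (a′<b 0) eq)) j j<k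

-- If R_b(e) divides an e-digit numeral with digits below b, all its digits are equal:
-- the quotient c is below b (by size) and the numeral is then c·R_b(e), the constant numeral.
repunit-multiple⇒constant : ∀ b e a → (∀ j → a j < b) → repunit b e ∣ℕ digits b a e →
  ∀ j → j < e → a j ≡ a 0
repunit-multiple⇒constant b (suc e) a a<b (divides c eq) j j<e =
  trans (all-c j j<e) (sym (all-c 0 (s≤s z≤n)))
  where
  open ≤-Reasoning
  c<b : c < b
  c<b = ≰⇒> λ b≤c → <-irrefl refl (begin-strict
    b ^ suc e               ≤⟨ power≤base*repunit b e ⟩
    b * repunit b (suc e)   ≤⟨ *-monoˡ-≤ (repunit b (suc e)) b≤c ⟩
    c * repunit b (suc e)   ≡⟨ sym eq ⟩
    digits b a (suc e)      <⟨ digits-bound b a (suc e) a<b ⟩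
    b ^ suc e               ∎)
  all-c : ∀ j → j < suc e → a j ≡ c
  all-c = digits-injective b a (λ _ → c) (suc e) a<b (λ _ → c<b)
    (trans eq (sym (digits-const b c (suc e))))

modulus-repunit : ∀ p d e M → 1 < p → 0 < d → M * (p ^ d ∸ 1) ≡ p ^ (e * d) ∸ 1 →
  M ≡ repunit (p ^ d) e
modulus-repunit p d e M 1<p 0<d eq = repunit-unique (p ^ d) e M (^-monoʳ-< p 1<p 0<d)
  (trans eq (cong (_∸ 1) (trans (cong (p ^_) (*-comm e d)) (sym (^-*-assoc p d e)))))

modulus-multiple⇒periodic : ∀ p d e M a → 1 < p → 0 < d → 1 < e → (∀ j → a j < p) →
  M * (p ^ d ∸ 1) ≡ p ^ (e * d) ∸ 1 → M ∣ℕ digits p a (e * d) → a d ≡ a 0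
modulus-multiple⇒periodic p d e M a 1<p 0<d 1<e a<p eq M∣a =
  trans (cong a (sym block-1-start))
        (digits-injective p _ _ d (λ _ → a<p _) (λ _ → a<p _) blocks-agree 0 0<d)
  where
  block<q : ∀ j → block p d a j < p ^ d
  block<q j = digits-bound p _ d (λ _ → a<p _)
  blocks-agree : block p d a 1 ≡ block p d a 0
  blocks-agree = repunit-multiple⇒constant (p ^ d) e (block p d a) block<q
    (subst₂ _∣ℕ_ (modulus-repunit p d e M 1<p 0<d eq) (digits-blocks p d e a) M∣a) 1 1<e
  -- digit 0 of block 1 is digit d of a
  block-1-start : 1 * d + 0 ≡ d
  block-1-start = trans (+-identityʳ (1 * d)) (*-identityˡ d)

proper-divisor : ∀ {d m} → 0 < m → d ∣ℕ m → d ≢ m → ∃ λ e → 1 < e × m ≡ e * d × 0 < d × d < m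
proper-divisor {zero}  0<m (divides e m≡e*0) _ =
  contradiction (trans m≡e*0 (*-zeroʳ e)) (>⇒≢ 0<m)
proper-divisor {suc d} () (divides zero refl) _
proper-divisor {suc d} _  (divides (suc zero) refl) d≢m =
  contradiction (sym (+-identityʳ (suc d))) d≢m
proper-divisor {suc d} _  (divides (suc (suc e)) refl) _ =
  suc (suc e) , s≤s (s≤s z≤n) , refl , s≤s z≤n , m<m+n (suc d) (s≤s z≤n)

rho-shift : ∀ {n} (i j : Fin n) → toℕ i ≤ toℕ j → ∃ λ k → k < n × rho n i ≡ rho n j ℤ.+ ℤ.+ k
rho-shift {suc n} i j i≤j =
  toℕ j ∸ toℕ i , s≤s (≤-trans (m∸n≤m (toℕ j) (toℕ i)) j≤n) ,
  trans (cong ℤ.+_ split) (ℤₚ.pos-+ (n ∸ toℕ j) (toℕ j ∸ toℕ i))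
  where
  open ≡-Reasoning
  j≤n : toℕ j ≤ n
  j≤n = toℕ≤pred[n] j
  split : n ∸ toℕ i ≡ (n ∸ toℕ j) + (toℕ j ∸ toℕ i)
  split = begin
    n ∸ toℕ i                   ≡⟨ cong (_∸ toℕ i) (sym (m∸n+n≡m j≤n)) ⟩
    (n ∸ toℕ j) + toℕ j ∸ toℕ i ≡⟨ +-∸-assoc (n ∸ toℕ j) i≤j ⟩
    (n ∸ toℕ j) + (toℕ j ∸ toℕ i) ∎

-- In an n-deep weight the entries strictly decrease along the positions, by
-- steps below p: the depth n exceeds every shift of ρ.
deep-gap : ∀ {n p μ} → Deep n p n μ → ∀ i j → toℕ i < toℕ j →
  ∃ λ v → 0 < v × v < p × μ i ≡ μ j ℤ.+ ℤ.+ v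
deep-gap {n} {p} {μ} deep i j i<j with rho-shift i j (<⇒≤ i<j)
... | k , k<n , ρ-shift = ℤ.∣ g ∣ , 0<v , v<p , μ-step
  where
  g : ℤ
  g = μ i ℤ.- μ j
  rearrange : ∀ x y r s → (x ℤ.+ (r ℤ.+ s)) ℤ.- (y ℤ.+ r) ≡ (x ℤ.- y) ℤ.+ s
  rearrange = ℤRing.solve-∀
  split : ∀ x y → x ≡ y ℤ.+ (x ℤ.- y)
  split = ℤRing.solve-∀
  pairing-split : pairing μ i j ≡ g ℤ.+ ℤ.+ k
  pairing-split = trans (cong (λ r → (μ i ℤ.+ r) ℤ.- (μ j ℤ.+ rho n j)) ρ-shift)
                        (rearrange (μ i) (μ j) (rho n j) (ℤ.+ k))
  lower : ℤ.+ n ℤ.< g ℤ.+ ℤ.+ k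
  lower = subst (ℤ.+ n ℤ.<_) pairing-split (proj₁ (deep i j i<j))
  upper : g ℤ.+ ℤ.+ k ℤ.< ℤ.+ p ℤ.- ℤ.+ n
  upper = subst (ℤ._< ℤ.+ p ℤ.- ℤ.+ n) pairing-split (proj₂ (deep i j i<j))
  -- if g ≤ 0 then g + k ≤ k < n, contradicting the lower bound
  0<g : ℤ.+ 0 ℤ.< g
  0<g = ℤₚ.≰⇒> λ g≤0 → ℤₚ.<-asym lower (ℤₚ.≤-<-trans (ℤₚ.+-monoˡ-≤ (ℤ.+ k) g≤0) (ℤ.+<+ k<n))
  g<p : g ℤ.< ℤ.+ p
  g<p = ℤₚ.≤-<-trans (ℤₚ.i≤i+j g (ℤ.+ k)) (ℤₚ.<-≤-trans upper (ℤₚ.i-j≤i (ℤ.+ p) (ℤ.+ n)))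
  ∣g∣≡g : ℤ.+ ℤ.∣ g ∣ ≡ g
  ∣g∣≡g = ℤₚ.0≤i⇒+∣i∣≡i (ℤₚ.<⇒≤ 0<g)
  0<v : 0 < ℤ.∣ g ∣
  0<v = ℤₚ.drop‿+<+ (subst (ℤ.+ 0 ℤ.<_) (sym ∣g∣≡g) 0<g)
  v<p : ℤ.∣ g ∣ < p
  v<p = ℤₚ.drop‿+<+ (subst (ℤ._< ℤ.+ p) (sym ∣g∣≡g) g<p)
  μ-step : μ i ≡ μ j ℤ.+ ℤ.+ ℤ.∣ g ∣
  μ-step = trans (split (μ i) (μ j)) (cong (λ t → μ j ℤ.+ t) (sym ∣g∣≡g))

module Offsets {n p : ℕ} (μ : Fin (suc n) → ℤ) (0<p : 0 < p)
               (deep : Deep (suc n) p (suc n) μ) where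

  last : Fin (suc n)
  last = fromℕ n

  gap : ∀ i j → toℕ i < toℕ j → ∃ λ v → 0 < v × v < p × μ i ≡ μ j ℤ.+ ℤ.+ v
  gap = deep-gap {suc n} {p} {μ} deep

  offset-exists : ∀ x → ∃ λ v → v < p × μ x ≡ μ last ℤ.+ ℤ.+ v
  offset-exists x with m≤n⇒m<n∨m≡n (toℕ≤pred[n] x)
  ... | inj₁ x<n with gap x last (subst (toℕ x <_) (sym (toℕ-fromℕ n)) x<n)
  ...   | v , _ , v<p , μ-step = v , v<p , μ-step
  offset-exists x | inj₂ x≡n =
    0 , 0<p , trans (cong μ x≡last) (sym (ℤₚ.+-identityʳ (μ last)))
    where
    x≡last : x ≡ last
    x≡last = toℕ-injective (trans x≡n (sym (toℕ-fromℕ n)))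

  offset : Fin (suc n) → ℕ
  offset x = proj₁ (offset-exists x)

  offset<p : ∀ x → offset x < p
  offset<p x = proj₁ (proj₂ (offset-exists x))

  offset-spec : ∀ x → μ x ≡ μ last ℤ.+ ℤ.+ offset x
  offset-spec x = proj₂ (proj₂ (offset-exists x))

  gap⇒distinct : ∀ i j → toℕ i < toℕ j → μ i ≢ μ j
  gap⇒distinct i j i<j μi≡μj with gap i j i<j
  ... | v , 0<v , _ , μ-step = <⇒≢ 0<v (ℤₚ.+-injective (∙-cancelˡ (μ j) (ℤ.+ 0) (ℤ.+ v) (begin
    μ j ℤ.+ ℤ.+ 0 ≡⟨ ℤₚ.+-identityʳ (μ j) ⟩
    μ j           ≡⟨ sym μi≡μj ⟩
    μ i           ≡⟨ μ-step ⟩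
    μ j ℤ.+ ℤ.+ v ∎)))
    where open ≡-Reasoning

  μ-injective : ∀ x y → μ x ≡ μ y → x ≡ y
  μ-injective x y μx≡μy with <-cmp (toℕ x) (toℕ y)
  ... | tri< x<y _ _ = contradiction μx≡μy (gap⇒distinct x y x<y)
  ... | tri≈ _ x≡y _ = toℕ-injective x≡y
  ... | tri> _ _ y<x = contradiction (sym μx≡μy) (gap⇒distinct y x y<x)

  offset-injective : ∀ {x y} → offset x ≡ offset y → x ≡ y
  offset-injective {x} {y} eq =
    μ-injective x y (trans (offset-spec x)
      (trans (cong (λ v → μ last ℤ.+ ℤ.+ v) eq) (sym (offset-spec y))))

orbitSum-split : ∀ {n} (w : Permutation′ n) (μ : Fin n → ℤ) p c (a : Fin n → ℕ) →
  (∀ x → μ x ≡ c ℤ.+ ℤ.+ a x) → ∀ i m →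
  orbitSum w μ p i m ≡ c ℤ.* ℤ.+ repunit p m ℤ.+ ℤ.+ digits p (λ k → a (iterPerm w k i)) m
orbitSum-split w μ p c a μ≡c+a i zero    = sym (trans (ℤₚ.+-identityʳ _) (ℤₚ.*-zeroʳ c))
orbitSum-split {n} w μ p c a μ≡c+a i (suc m) = begin
  orbitSum w μ p i m ℤ.+ μ x ℤ.* ℤ.+ P
    ≡⟨ cong₂ (λ s t → s ℤ.+ t ℤ.* ℤ.+ P) (orbitSum-split w μ p c a μ≡c+a i m) (μ≡c+a x) ⟩
  (c ℤ.* ℤ.+ R ℤ.+ ℤ.+ D) ℤ.+ (c ℤ.+ ℤ.+ a x) ℤ.* ℤ.+ P
    ≡⟨ rearrange c (ℤ.+ R) (ℤ.+ D) (ℤ.+ a x) (ℤ.+ P) ⟩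
  c ℤ.* (ℤ.+ R ℤ.+ ℤ.+ P) ℤ.+ (ℤ.+ D ℤ.+ ℤ.+ a x ℤ.* ℤ.+ P)
    ≡⟨ cong₂ (λ s t → c ℤ.* s ℤ.+ (ℤ.+ D ℤ.+ t))
             (sym (ℤₚ.pos-+ R P)) (sym (ℤₚ.pos-* (a x) P)) ⟩
  c ℤ.* ℤ.+ (R + P) ℤ.+ (ℤ.+ D ℤ.+ ℤ.+ (a x * P))
    ≡⟨ cong (λ t → c ℤ.* ℤ.+ (R + P) ℤ.+ t) (sym (ℤₚ.pos-+ D (a x * P))) ⟩
  c ℤ.* ℤ.+ (R + P) ℤ.+ ℤ.+ (D + a x * P)
    ≡⟨ cong₂ (λ s t → c ℤ.* ℤ.+ s ℤ.+ ℤ.+ t)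
             (sym (repunit-snoc p m)) (sym (digits-snoc p orbit m)) ⟩
  c ℤ.* ℤ.+ repunit p (suc m) ℤ.+ ℤ.+ digits p orbit (suc m) ∎
  where
  open ≡-Reasoning
  orbit : ℕ → ℕ
  orbit k = a (iterPerm w k i)
  x : Fin n
  x = iterPerm w m i
  P R D : ℕ
  P = p ^ m
  R = repunit p m
  D = digits p orbit m
  rearrange : ∀ c R D A P →
    (c ℤ.* R ℤ.+ D) ℤ.+ (c ℤ.+ A) ℤ.* P ≡ c ℤ.* (R ℤ.+ P) ℤ.+ (D ℤ.+ A ℤ.* P)
  rearrange = ℤRing.solve-∀

deep⇒good : ∀ {n} p (w : Permutation′ (suc n)) (μ : Fin (suc n) → ℤ) → 1 < p →
  Deep (suc n) p (suc n) μ → Good (suc n) w μ p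
deep⇒good p w μ 1<p deep i m (0<m , _ , minimal) d d∣m d≢m M quotient M∣orbitSum
  with proper-divisor 0<m d∣m d≢m
... | e , 1<e , refl , 0<d , d<m = minimal d 0<d d<m (offset-injective periodic)
  where
  open Offsets μ (<-trans (s≤s z≤n) 1<p) deep
  a : ℕ → ℕ
  a k = offset (iterPerm w k i)
  -- M = R_{p^d}(e) divides R_p(e·d) = R_p(d) · R_{p^d}(e)
  M∣repunit : M ∣ℕ repunit p (e * d)
  M∣repunit = divides (repunit p d) (trans (repunit-blocks p d e)
    (cong (repunit p d *_) (sym (modulus-repunit p d e M 1<p 0<d quotient))))
  -- hence M divides the digit part of the orbit sum
  M∣digits : M ∣ℕ digits p a (e * d)
  M∣digits = ℤ∣.∣⇒∣ᵤ (ℤ∣.∣m+n∣m⇒∣n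
    (subst (ℤ.+ M ℤ∣.∣_) (orbitSum-split w μ p (μ last) offset offset-spec i (e * d))
           (ℤ∣.∣ᵤ⇒∣ M∣orbitSum))
    (ℤ∣.∣n⇒∣m*n (μ last) (ℤ∣.∣ᵤ⇒∣ M∣repunit)))
  periodic : offset (iterPerm w d i) ≡ offset i
  periodic = modulus-multiple⇒periodic p d e M a 1<p 0<d 1<e
    (λ k → offset<p (iterPerm w k i)) quotient M∣digits

lemma6p23 : (n : ℕ) (w : Permutation′ n) →
    ∃ λ (δ : ℕ) → ∀ (p : ℕ) → Prime p → ∀ (μ : Fin n → ℤ) →
    Deep n p δ μ → Good n w μ p
lemma6p23 zero    w = 0 , λ _ _ _ _ ()
lemma6p23 (suc n) w = suc n , λ p p-prime μ →
  deep⇒good p w μ (nonTrivial⇒n>1 p {{prime⇒nonTrivial p-prime}})
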